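{- Let $G=(V,E)$ be a connected finite simple graph with $n=|V|$, and let $\mathcal G$ be the graph constructed from $G$ as described in the context. Let $\mathcal S$ be a proper stalled subset of the vertex set of $\mathcal G$ such that $|\mathcal S|\geqslant (2n+1)|E|+2$. Then $\varepsilon\notin\mathcal S$.
   Context: For a finite simple graph $H$ with vertex set $W$ and a set $F\subseteq W$: a vertex $v\in W\setminus F$ is forced by $F$ if there is $u\in F$ such that $v$ is the unique neighbor of $u$ outside $F$. $F$ is stalled if no vertex of $W\setminus F$ is forced by $F$; $F$ is proper if $F\neq W$. Construction of $\mathcal G$: given $G=(V,E)$ with $n=|V|$, let $E^i=\{e^i : e\in E\}$ for $i=0,1,\dots,2n$ be $2n+1$ pairwise disjoint copies of $E$ (disjoint from $V$), and let $\varepsilon$ be a further new vertex. The vertex set of $\mathcal G$ is $\mathcal V=V\cup E^0\cup\dots\cup E^{2n}\cup\{\varepsilon\}$. The edges of $\mathcal G$ are exactly: for every edge $e=\{u,v\}\in E$, the edges $\{u,e^0\}$ and $\{e^0,v\}$; the edges $\{e^i,e^{i+1}\}$ for $0\le i\le 2n-1$; and the edge $\{\varepsilon,e^0\}$. -}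

module Defs where

open import Data.Nat using (ℕ; zero; suc; _+_; _*_)
open import Data.Fin using (Fin; inject₁) renaming (zero to fzero; suc to fsuc)
open import Data.Product using (Σ; ∃; _×_; _,_; proj₁; proj₂)
open import Data.Sum using (_⊎_)
open import Data.Bool using (Bool; true; false)
open import Data.List using (List; []; _∷_; _++_; map; concatMap; filter; length; allFin)
open import Relation.Nullary using (¬_)
open import Relation.Binary.PropositionalEquality using (_≡_; _≢_)
open import Relation.Binary.Construct.Closure.ReflexiveTransitive using (Star)
import Data.Bool.Properties as BoolP

record Graph : Set where
  field
    n    : ℕ
    m    : ℕ
    ends : Fin m → Fin n × Fin n
    noLoop : ∀ e → proj₁ (ends e) ≢ proj₂ (ends e)
    noMulti : ∀ e f →
      ((proj₁ (ends e) ≡ proj₁ (ends f)) × (proj₂ (ends e) ≡ proj₂ (ends f)))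
      ⊎ ((proj₁ (ends e) ≡ proj₂ (ends f)) × (proj₂ (ends e) ≡ proj₁ (ends f)))
      → e ≡ f

open Graph public

IsEnd : (G : Graph) → Fin (n G) → Fin (m G) → Set
IsEnd G u e = (u ≡ proj₁ (ends G e)) ⊎ (u ≡ proj₂ (ends G e))

AdjG : (G : Graph) → Fin (n G) → Fin (n G) → Set
AdjG G u v = ∃ λ e → ((u ≡ proj₁ (ends G e)) × (v ≡ proj₂ (ends G e)))
                   ⊎ ((v ≡ proj₁ (ends G e)) × (u ≡ proj₂ (ends G e)))

Connected : Graph → Set
Connected G = ∀ u v → Star (AdjG G) u v

-- Vertices of the constructed graph 𝒢:
-- vtx v (v ∈ V), cp i e = e^i for i = 0..2n, and eps = ε.
data 𝒱 (G : Graph) : Set where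
  vtx : Fin (n G) → 𝒱 G
  cp  : Fin (suc (2 * n G)) → Fin (m G) → 𝒱 G
  eps : 𝒱 G

data Adj𝒢 (G : Graph) : 𝒱 G → 𝒱 G → Set where
  v-e0 : ∀ {u e} → IsEnd G u e → Adj𝒢 G (vtx u) (cp fzero e)
  e0-v : ∀ {u e} → IsEnd G u e → Adj𝒢 G (cp fzero e) (vtx u)
  up   : ∀ (i : Fin (2 * n G)) e → Adj𝒢 G (cp (inject₁ i) e) (cp (fsuc i) e)
  down : ∀ (i : Fin (2 * n G)) e → Adj𝒢 G (cp (fsuc i) e) (cp (inject₁ i) e)
  ε-e0 : ∀ e → Adj𝒢 G eps (cp fzero e)
  e0-ε : ∀ e → Adj𝒢 G (cp fzero e) eps

all𝒱 : (G : Graph) → List (𝒱 G)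
all𝒱 G = map vtx (allFin (n G))
      ++ concatMap (λ i → map (cp i) (allFin (m G))) (allFin (suc (2 * n G)))
      ++ (eps ∷ [])

Subset𝒢 : Graph → Set
Subset𝒢 G = 𝒱 G → Bool

card : (G : Graph) → Subset𝒢 G → ℕ
card G F = length (filter (λ x → F x BoolP.≟ true) (all𝒱 G))

Forced : (G : Graph) → Subset𝒢 G → 𝒱 G → Set
Forced G F v = (F v ≡ false) × ∃ λ u → (F u ≡ true) × Adj𝒢 G u v
               × (∀ w → Adj𝒢 G u w → F w ≡ false → w ≡ v)

Stalled : (G : Graph) → Subset𝒢 G → Set
Stalled G F = ∀ v → F v ≡ false → ¬ Forced G F v

Proper : (G : Graph) → Subset𝒢 G → Set
Proper G F = ¬ (∀ v → F v ≡ true)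

-- Suppose ε ∈ 𝒮.  The size bound leaves fewer than n vertices outside 𝒮, and we
-- show that at least n lie outside.  A stalled set containing the middle vertex
-- of a path e^(j-1), e^j, e^(j+1) contains both or neither of its ends, so each
-- copy-chain e^0, …, e^2n is either wholly inside 𝒮 (when e^0, e^1 ∈ 𝒮) or has no
-- two consecutive vertices inside, and then misses at least one vertex of each of
-- the n pairs (e^(2j), e^(2j+1)).  If every chain is wholly inside, then e^0 ∈ 𝒮
-- has ε and e^1 in 𝒮, so the two endpoints of e are both in or both out of 𝒮; by
-- connectivity and properness all n vertices of G are then outside 𝒮.
module Submission where

open import Defs
open import Data.Nat using (ℕ; zero; suc; _+_; _*_; _≤_; _<_; _≥_; z≤n; s≤s)
open import Data.Nat.Properties
  using (module ≤-Reasoning; ≤-trans; n≤1+n; suc-injective; ≤-pred; +-suc; +-comm; *-comm; +-monoʳ-≤; +-cancelʳ-≤; <⇒≱)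
open import Data.Bool using (Bool; true; false)
open import Data.Bool.Properties using (_≟_; ¬-not)
open import Data.Fin using (Fin; toℕ; fromℕ<; inject₁) renaming (zero to fzero; suc to fsuc)
open import Data.Fin.Properties using (toℕ<n; toℕ-inject₁; toℕ-fromℕ<; all?; ¬∀⟶∃¬)
open import Data.List using (List; []; _∷_; map; concatMap; filter; length; allFin; applyUpTo; tabulate)
open import Data.List.Properties using (length-++; length-map; length-tabulate; filter-all; map-tabulate)
open import Data.List.Membership.Propositional using (_∈_)
open import Data.List.Membership.Propositional.Properties using (∈-map⁺; ∈-allFin)
open import Data.List.Relation.Binary.Sublist.Propositional using (_⊆_; _∷ʳ_; ⊆-refl; ⊆-trans; ⊆-reflexive; from∈)
open import Data.List.Relation.Binary.Sublist.Propositional.Properties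
  using (++⁺; ++⁺ˡ; ++⁺ʳ; filter⁺; length-mono-≤)
open import Data.List.Relation.Unary.All using (All; universal)
open import Data.List.Relation.Unary.All.Properties using (map⁺)
open import Data.Product using (∃; _×_; _,_; proj₁; proj₂)
open import Data.Sum using (_⊎_; inj₁; inj₂)
open import Data.Empty using (⊥; ⊥-elim)
open import Function using (_∘_)
open import Relation.Nullary using (¬_; Dec; yes; no; contradiction)
open import Relation.Nullary.Decidable using (_×-dec_)
open import Relation.Binary.PropositionalEquality
import Relation.Binary.Construct.Closure.ReflexiveTransitive as Star

private
  variable
    A B : Set

-- Saturates at K, so that chain e j below is e^j for every j ≤ 2n.
clamp : (K : ℕ) → ℕ → Fin (suc K)
clamp K       zero    = fzero
clamp zero    (suc j) = fzero
clamp (suc K) (suc j) = fsuc (clamp K j)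

clamp-toℕ : ∀ K (i : Fin (suc K)) → clamp K (toℕ i) ≡ i
clamp-toℕ K       fzero    = refl
clamp-toℕ (suc K) (fsuc i) = cong fsuc (clamp-toℕ K i)

toℕ-clamp : ∀ K {j} → j ≤ K → toℕ (clamp K j) ≡ j
toℕ-clamp K       {zero}  _         = refl
toℕ-clamp (suc K) {suc j} (s≤s j≤K) = cong suc (toℕ-clamp K j≤K)

≡clamp : ∀ K {i : Fin (suc K)} {j} → toℕ i ≡ j → i ≡ clamp K j
≡clamp K {i} refl = sym (clamp-toℕ K i)

inject₁-fromℕ<≡clamp : ∀ {K j} (j<K : j < K) → inject₁ (fromℕ< j<K) ≡ clamp K j
inject₁-fromℕ<≡clamp {K} j<K = ≡clamp K (trans (toℕ-inject₁ (fromℕ< j<K)) (toℕ-fromℕ< j<K))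

suc-fromℕ<≡clamp : ∀ {K j} (j<K : j < K) → fsuc (fromℕ< j<K) ≡ clamp K (suc j)
suc-fromℕ<≡clamp {K} j<K = ≡clamp K (cong suc (toℕ-fromℕ< j<K))

tabulate-clamp : ∀ K (f : Fin (suc K) → A) → tabulate f ≡ applyUpTo (f ∘ clamp K) (suc K)
tabulate-clamp zero    f = refl
tabulate-clamp (suc K) f = cong (f fzero ∷_) (tabulate-clamp K (f ∘ fsuc))

-- The trace of a stalled set on a chain: an interior entry in the set forces its
-- two neighbours to agree.
StalledSeq : ℕ → (ℕ → Bool) → Set
StalledSeq K b = ∀ j → 2 + j ≤ K → b (suc j) ≡ true → b j ≡ b (2 + j)

module _ {K : ℕ} {b : ℕ → Bool} (stalled : StalledSeq K b) where

  stalledSeq-descend : ∀ j → suc j ≤ K → b j ≡ true → b (suc j) ≡ true → b 0 ≡ true × b 1 ≡ true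
  stalledSeq-descend zero    _  b₀ b₁ = b₀ , b₁
  stalledSeq-descend (suc j) le bⱼ₊₁ bⱼ₊₂ =
    stalledSeq-descend j (≤-trans (n≤1+n _) le) (trans (stalled j le bⱼ₊₁) bⱼ₊₂) bⱼ₊₁

  stalledSeq-ascend : b 0 ≡ true → b 1 ≡ true → ∀ j → suc j ≤ K → b j ≡ true × b (suc j) ≡ true
  stalledSeq-ascend b₀ b₁ zero    _  = b₀ , b₁
  stalledSeq-ascend b₀ b₁ (suc j) le with stalledSeq-ascend b₀ b₁ j (≤-trans (n≤1+n _) le)
  ... | bⱼ , bⱼ₊₁ = bⱼ₊₁ , trans (sym (stalled j le bⱼ₊₁)) bⱼ

  stalledSeq-full : b 0 ≡ true → b 1 ≡ true → ∀ j → j ≤ K → b j ≡ true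
  stalledSeq-full b₀ b₁ zero    _  = b₀
  stalledSeq-full b₀ b₁ (suc j) le = proj₂ (stalledSeq-ascend b₀ b₁ j le)

outside : (A → Bool) → List A → ℕ
outside S xs = length (filter (λ x → S x ≟ false) xs)

inside+outside : ∀ (S : A → Bool) xs → length (filter (λ x → S x ≟ true) xs) + outside S xs ≡ length xs
inside+outside S []       = refl
inside+outside S (x ∷ xs) with S x
... | true  = cong suc (inside+outside S xs)
... | false = trans (+-suc _ _) (cong suc (inside+outside S xs))

outside-mono : ∀ (S : A → Bool) {xs ys} → xs ⊆ ys → outside S xs ≤ outside S ys
outside-mono S xs⊆ys = length-mono-≤ (filter⁺ (λ x → S x ≟ false) (λ x → S x ≟ false) (λ { refl p → p }) xs⊆ys)

outside-allOut : ∀ (S : A → Bool) {xs} → All (λ x → S x ≡ false) xs → outside S xs ≡ length xs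
outside-allOut S allOut = cong length (filter-all (λ x → S x ≟ false) allOut)

-- Each pair (x (2j), x (2j+1)) contributes an outside entry.
outside-noAdjacent : ∀ (S : A → Bool) k (x : ℕ → A) →
  (∀ j → suc j ≤ k * 2 → S (x j) ≡ true → S (x (suc j)) ≡ true → ⊥) →
  k ≤ outside S (applyUpTo x (suc (k * 2)))
outside-noAdjacent S zero    x _     = z≤n
outside-noAdjacent S (suc k) x noAdj
  with rest ← outside-noAdjacent S k (x ∘ suc ∘ suc) (λ j le → noAdj (2 + j) (s≤s (s≤s le)))
     | S (x 0) in S₀
... | false = s≤s (≤-trans rest (outside-mono S (x 1 ∷ʳ ⊆-refl)))
... | true with S (x 1) in S₁
...   | true  = ⊥-elim (noAdj 0 (s≤s z≤n) S₀ S₁)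
...   | false = s≤s rest

map⊆concatMap : ∀ {g : A → B} {f : A → List B} → (∀ x → g x ∈ f x) → ∀ xs → map g xs ⊆ concatMap f xs
map⊆concatMap g∈f []       = ⊆-refl
map⊆concatMap g∈f (x ∷ xs) = ++⁺ (from∈ (g∈f x)) (map⊆concatMap g∈f xs)

length-concatMap-const : ∀ (f : A → List B) {c} → (∀ x → length (f x) ≡ c) →
  ∀ xs → length (concatMap f xs) ≡ length xs * c
length-concatMap-const f f≡c []       = refl
length-concatMap-const f f≡c (x ∷ xs) =
  trans (length-++ (f x)) (cong₂ _+_ (f≡c x) (length-concatMap-const f f≡c xs))

stalled⇒sameSide : ∀ {G S u v w} → Stalled G S → S u ≡ true → Adj𝒢 G u v → Adj𝒢 G u w →
  (∀ z → Adj𝒢 G u z → S z ≡ false → z ≡ v ⊎ z ≡ w) → S v ≡ S w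
stalled⇒sameSide {G} {S} {u} {v} {w} stalled Su uv uw candidates with S v in Sv | S w in Sw
... | true  | true  = refl
... | false | false = refl
... | false | true  = ⊥-elim (stalled v Sv (Sv , u , Su , uv , only))
  where
  only : ∀ z → Adj𝒢 G u z → S z ≡ false → z ≡ v
  only z uz Sz with candidates z uz Sz
  ... | inj₁ z≡v = z≡v
  ... | inj₂ refl = contradiction (trans (sym Sw) Sz) λ ()
... | true  | false = ⊥-elim (stalled w Sw (Sw , u , Su , uw , only))
  where
  only : ∀ z → Adj𝒢 G u z → S z ≡ false → z ≡ w
  only z uz Sz with candidates z uz Sz
  ... | inj₁ refl = contradiction (trans (sym Sv) Sz) λ ()
  ... | inj₂ z≡w = z≡w

cp-neighbour : ∀ {G i e w} → Adj𝒢 G (cp i e) w →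
  (toℕ i ≡ 0 × (w ≡ eps ⊎ ∃ λ u → IsEnd G u e × w ≡ vtx u))
  ⊎ ∃ λ j → w ≡ cp j e × (toℕ j ≡ suc (toℕ i) ⊎ suc (toℕ j) ≡ toℕ i)
cp-neighbour (e0-v p)   = inj₁ (refl , inj₂ (_ , p , refl))
cp-neighbour (up k e)   = inj₂ (fsuc k , refl , inj₁ (cong suc (sym (toℕ-inject₁ k))))
cp-neighbour (down k e) = inj₂ (inject₁ k , refl , inj₂ (cong suc (toℕ-inject₁ k)))
cp-neighbour (e0-ε e)   = inj₁ (refl , inj₁ refl)

module _ (G : Graph) where

  private
    K : ℕ
    K = 2 * n G

  chain : Fin (m G) → ℕ → 𝒱 G
  chain e j = cp (clamp K j) e

  chain-up : ∀ e {j} → suc j ≤ K → Adj𝒢 G (chain e j) (chain e (suc j))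
  chain-up e le = subst₂ (λ a b → Adj𝒢 G (cp a e) (cp b e))
    (inject₁-fromℕ<≡clamp le) (suc-fromℕ<≡clamp le) (up (fromℕ< le) e)

  chain-down : ∀ e {j} → suc j ≤ K → Adj𝒢 G (chain e (suc j)) (chain e j)
  chain-down e le = subst₂ (λ a b → Adj𝒢 G (cp a e) (cp b e))
    (suc-fromℕ<≡clamp le) (inject₁-fromℕ<≡clamp le) (down (fromℕ< le) e)

  chain-interior-neighbour : ∀ e {j w} → 2 + j ≤ K → Adj𝒢 G (chain e (suc j)) w →
    w ≡ chain e j ⊎ w ≡ chain e (2 + j)
  chain-interior-neighbour e le adj with cp-neighbour adj | toℕ-clamp K (≤-trans (n≤1+n _) le)
  ... | inj₁ (level≡0 , _)           | level = contradiction (trans (sym level) level≡0) λ ()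
  ... | inj₂ (i , refl , inj₁ above) | level = inj₂ (cong (λ a → cp a e) (≡clamp K (trans above (cong suc level))))
  ... | inj₂ (i , refl , inj₂ below) | level = inj₁ (cong (λ a → cp a e) (≡clamp K (suc-injective (trans below level))))

  chain⊆all𝒱 : ∀ e → applyUpTo (chain e) (suc K) ⊆ all𝒱 G
  chain⊆all𝒱 e = ⊆-trans (⊆-reflexive chain≡) (++⁺ˡ (map vtx (allFin (n G))) (++⁺ʳ (eps ∷ []) copies))
    where
    chain≡ : applyUpTo (chain e) (suc K) ≡ map (λ i → cp i e) (allFin (suc K))
    chain≡ = sym (trans (map-tabulate (λ i → i) (λ i → cp i e)) (tabulate-clamp K (λ i → cp i e)))
    copies : map (λ i → cp i e) (allFin (suc K)) ⊆ concatMap (λ i → map (cp i) (allFin (m G))) (allFin (suc K))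
    copies = map⊆concatMap (λ i → ∈-map⁺ (cp i) (∈-allFin e)) (allFin (suc K))

  length-all𝒱 : length (all𝒱 G) ≡ n G + (suc K * m G + 1)
  length-all𝒱 = trans (length-++ vertices) (cong₂ _+_ vertexCount (trans (length-++ copies) (cong (_+ 1) copyCount)))
    where
    vertices copies : List (𝒱 G)
    vertices = map vtx (allFin (n G))
    copies = concatMap (λ i → map (cp i) (allFin (m G))) (allFin (suc K))
    vertexCount : length vertices ≡ n G
    vertexCount = trans (length-map vtx (allFin (n G))) (length-tabulate (λ u → u))
    copyCount : length copies ≡ suc K * m G
    copyCount = trans
      (length-concatMap-const (λ i → map (cp i) (allFin (m G)))
        (λ i → trans (length-map (cp i) (allFin (m G))) (length-tabulate (λ e → e))) (allFin (suc K)))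
      (cong (_* m G) (length-tabulate {n = suc K} (λ i → i)))

  outside<n : ∀ S → card G S ≥ suc K * m G + 2 → outside S (all𝒱 G) < n G
  outside<n S big = +-cancelʳ-≤ (c + 1) (suc o) (n G) (begin
    suc o + (c + 1)  ≡⟨ sym (trans (cong (o +_) (+-suc c 1)) (+-suc o (c + 1))) ⟩
    o + (c + 2)      ≤⟨ +-monoʳ-≤ o big ⟩
    o + card G S     ≡⟨ +-comm o (card G S) ⟩
    card G S + o     ≡⟨ inside+outside S (all𝒱 G) ⟩
    length (all𝒱 G) ≡⟨ length-all𝒱 ⟩
    n G + (c + 1)    ∎)
    where
    open ≤-Reasoning
    c o : ℕ
    c = suc K * m G
    o = outside S (all𝒱 G)

  module _ {S : Subset𝒢 G} (stalled : Stalled G S) where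

    chain-stalled : ∀ e → StalledSeq K (S ∘ chain e)
    chain-stalled e j le middle = stalled⇒sameSide stalled middle
      (chain-down e (≤-trans (n≤1+n _) le)) (chain-up e le) (λ _ adj _ → chain-interior-neighbour e le adj)

    Intact : Fin (m G) → Set
    Intact e = S (chain e 0) ≡ true × S (chain e 1) ≡ true

    intact? : ∀ e → Dec (Intact e)
    intact? e = (S (chain e 0) ≟ true) ×-dec (S (chain e 1) ≟ true)

    n≤outside-of-brokenChain : ∀ e → ¬ Intact e → n G ≤ outside S (all𝒱 G)
    n≤outside-of-brokenChain e broken = ≤-trans count (outside-mono S chain⊆)
      where
      chain⊆ : applyUpTo (chain e) (suc (n G * 2)) ⊆ all𝒱 G
      chain⊆ = subst (λ L → applyUpTo (chain e) (suc L) ⊆ all𝒱 G) (*-comm 2 (n G)) (chain⊆all𝒱 e)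
      count : n G ≤ outside S (applyUpTo (chain e) (suc (n G * 2)))
      count = outside-noAdjacent S (n G) (chain e) λ j le Sⱼ Sⱼ₊₁ →
        broken (stalledSeq-descend (chain-stalled e) j (subst (suc j ≤_) (*-comm (n G) 2) le) Sⱼ Sⱼ₊₁)

    -- e^0 ∈ 𝒮 with ε, e^1 ∈ 𝒮 leaves only the endpoints of e as outside candidates.
    ends-sameSide : S eps ≡ true → ∀ e → Intact e → S (vtx (proj₁ (ends G e))) ≡ S (vtx (proj₂ (ends G e)))
    ends-sameSide Sε e (S₀ , S₁) = stalled⇒sameSide stalled S₀ (e0-v (inj₁ refl)) (e0-v (inj₂ refl)) candidates
      where
      candidates : ∀ z → Adj𝒢 G (cp fzero e) z → S z ≡ false →
        z ≡ vtx (proj₁ (ends G e)) ⊎ z ≡ vtx (proj₂ (ends G e))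
      candidates z adj Sz with cp-neighbour adj
      ... | inj₁ (_ , inj₁ refl)                   = contradiction (trans (sym Sε) Sz) λ ()
      ... | inj₁ (_ , inj₂ (_ , inj₁ refl , refl)) = inj₁ refl
      ... | inj₁ (_ , inj₂ (_ , inj₂ refl , refl)) = inj₂ refl
      ... | inj₂ (i , refl , inj₁ i≡1)             =
        contradiction (trans (sym (trans (cong (λ a → S (cp a e)) (≡clamp K i≡1)) S₁)) Sz) λ ()
      ... | inj₂ (i , refl , inj₂ ())

    vertices-sameSide : S eps ≡ true → (∀ e → Intact e) → ∀ {u v} → Star.Star (AdjG G) u v → S (vtx u) ≡ S (vtx v)
    vertices-sameSide Sε intact = Star.fold (λ u v → S (vtx u) ≡ S (vtx v)) (λ uv → trans (edge uv)) refl
      where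
      edge : ∀ {u v} → AdjG G u v → S (vtx u) ≡ S (vtx v)
      edge (e , inj₁ (refl , refl)) = ends-sameSide Sε e (intact e)
      edge (e , inj₂ (refl , refl)) = sym (ends-sameSide Sε e (intact e))

    n≤outside-of-intactChains : Connected G → Proper G S → S eps ≡ true → (∀ e → Intact e) → n G ≤ outside S (all𝒱 G)
    n≤outside-of-intactChains connected proper Sε intact = begin
      n G                          ≡⟨ sym vertexCount ⟩
      outside S vertices           ≤⟨ outside-mono S vertices⊆all𝒱 ⟩
      outside S (all𝒱 G)          ∎
      where
      open ≤-Reasoning
      vertices : List (𝒱 G)
      vertices = map vtx (allFin (n G))
      vertices⊆all𝒱 : vertices ⊆ all𝒱 G
      vertices⊆all𝒱 = ++⁺ʳ _ ⊆-refl
      copiesIn : ∀ i e → S (cp i e) ≡ true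
      copiesIn i e = subst (λ a → S (cp a e) ≡ true) (clamp-toℕ K i)
        (stalledSeq-full (chain-stalled e) (proj₁ (intact e)) (proj₂ (intact e)) (toℕ i) (≤-pred (toℕ<n i)))
      someVertexOut : ∃ λ u → ¬ S (vtx u) ≡ true
      someVertexOut = ¬∀⟶∃¬ (n G) (λ u → S (vtx u) ≡ true) (λ u → S (vtx u) ≟ true)
        λ allIn → proper λ { (vtx u) → allIn u ; (cp i e) → copiesIn i e ; eps → Sε }
      allOut : ∀ u → S (vtx u) ≡ false
      allOut u = trans (sym (vertices-sameSide Sε intact (connected (proj₁ someVertexOut) u))) (¬-not (proj₂ someVertexOut))
      vertexCount : outside S vertices ≡ n G
      vertexCount = trans (outside-allOut S (map⁺ (universal allOut (allFin (n G)))))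
        (trans (length-map vtx (allFin (n G))) (length-tabulate (λ u → u)))

    n≤outside : Connected G → Proper G S → S eps ≡ true → n G ≤ outside S (all𝒱 G)
    n≤outside connected proper Sε with all? intact?
    ... | yes intact = n≤outside-of-intactChains connected proper Sε intact
    ... | no  notAllIntact = n≤outside-of-brokenChain (proj₁ broken) (proj₂ broken)
      where
      broken : ∃ λ e → ¬ Intact e
      broken = ¬∀⟶∃¬ (m G) Intact intact? notAllIntact

mainTheorem7 : (G : Graph) → Connected G → (S : Subset𝒢 G) → Proper G S → Stalled G S
    → card G S ≥ suc (2 * n G) * m G + 2 → S eps ≡ false
mainTheorem7 G connected S proper stalled big with S eps in Sε
... | false = refl
... | true  = contradiction (n≤outside G stalled connected proper Sε) (<⇒≱ (outside<n G S big))
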